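{- Let $G$ be an ultrahomogeneous CCD and let $\mathcal B$ be a block system of $\mathrm{Aut}(G)$. Then $G[X]$ is ultrahomogeneous for every $X\in\mathcal B$.
   Context: A complete colored digraph (CCD) $G$ consists of a finite non-empty vertex set $V(G)$, a vertex coloring and an edge coloring on all ordered pairs of distinct vertices; $G[X]$ is the induced CCD on $X$. Isomorphisms preserve both colorings; a partial isomorphism is an isomorphism between induced sub-CCDs; $G$ is ultrahomogeneous if every partial isomorphism extends to an automorphism. A block system of $\mathrm{Aut}(G)$ is a partition of $V(G)$ that is mapped to itself by every automorphism (equivalently, its parts $X$ satisfy $\varphi(X)=X$ or $\varphi(X)\cap X=\emptyset$ for all automorphisms $\varphi$). -}

module Defs where

open import Data.Nat using (ℕ; suc)
open import Data.Fin using (Fin)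
open import Data.Fin.Subset using (Subset; _∈_; ⊤)
open import Data.List using (List)
open import Data.List.Membership.Propositional renaming (_∈_ to _∈ˡ_)
open import Data.Product using (Σ; ∃; _×_; _,_)
open import Relation.Binary.PropositionalEquality using (_≡_; _≢_)
open import Relation.Nullary using (¬_)

-- The arc colouring is a
-- function on all ordered pairs; only its values on pairs of DISTINCT
-- vertices are ever used (loops carry no information).
record CCD (VC EC : Set) : Set where
  constructor ccd
  field
    m    : ℕ
    vcol : Fin (suc m) → VC
    ecol : Fin (suc m) → Fin (suc m) → EC

  V : Set
  V = Fin (suc m)

open CCD public

module _ {VC EC : Set} (G : CCD VC EC) where

  IsIsoBetween : Subset (suc (m G)) → Subset (suc (m G)) → (V G → V G) → Set
  IsIsoBetween A B f =
      (∀ u → u ∈ A → f u ∈ B)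
    × (∀ u v → u ∈ A → v ∈ A → f u ≡ f v → u ≡ v)
    × (∀ w → w ∈ B → ∃ λ u → u ∈ A × f u ≡ w)
    × (∀ u → u ∈ A → vcol G (f u) ≡ vcol G u)
    × (∀ u v → u ∈ A → v ∈ A → u ≢ v → ecol G (f u) (f v) ≡ ecol G u v)

  IsPartialIsoOn : Subset (suc (m G)) → Subset (suc (m G)) → Subset (suc (m G))
                 → (V G → V G) → Set
  IsPartialIsoOn X A B f =
      (∀ u → u ∈ A → u ∈ X) × (∀ u → u ∈ B → u ∈ X) × IsIsoBetween A B f

  IsAutOn : Subset (suc (m G)) → (V G → V G) → Set
  IsAutOn X φ = IsIsoBetween X X φ

  UltrahomogeneousOn : Subset (suc (m G)) → Set
  UltrahomogeneousOn X =
    ∀ A B f → IsPartialIsoOn X A B f →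
      ∃ λ φ → IsAutOn X φ × (∀ u → u ∈ A → φ u ≡ f u)

  IsAut : (V G → V G) → Set
  IsAut = IsAutOn ⊤

  Ultrahomogeneous : Set
  Ultrahomogeneous = UltrahomogeneousOn ⊤

  ImageIs : (V G → V G) → Subset (suc (m G)) → Subset (suc (m G)) → Set
  ImageIs φ X Y = ∀ w → (w ∈ Y → ∃ λ u → u ∈ X × φ u ≡ w)
                      × (∀ u → u ∈ X → φ u ≡ w → w ∈ Y)

  IsPartition : List (Subset (suc (m G))) → Set
  IsPartition 𝓑 =
      (∀ X → X ∈ˡ 𝓑 → ∃ λ v → v ∈ X)
    × (∀ v → ∃ λ X → X ∈ˡ 𝓑 × v ∈ X)
    × (∀ X Y v → X ∈ˡ 𝓑 → Y ∈ˡ 𝓑 → v ∈ X → v ∈ Y → X ≡ Y)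

  IsBlockSystem : List (Subset (suc (m G))) → Set
  IsBlockSystem 𝓑 =
      IsPartition 𝓑
    × (∀ φ → IsAut φ → ∀ X → X ∈ˡ 𝓑 → ∃ λ Y → Y ∈ˡ 𝓑 × ImageIs φ X Y)

{-# OPTIONS --safe #-}
module Submission where

open import Defs
open import Data.Empty using (⊥-elim)
open import Data.Fin.Subset using (Subset; ⊤) renaming (_∈_ to _∈ₛ_)
open import Data.Fin.Subset.Properties using (nonempty?; ∈⊤)
open import Data.List using (List)
open import Data.List.Membership.Propositional using (_∈_)
open import Data.Nat using (suc)
open import Data.Product using (_,_; proj₁; proj₂)
open import Function using (id)
open import Relation.Binary.PropositionalEquality using (_≡_; refl; subst; sym)
open import Relation.Nullary using (yes; no)

-- Extend a partial isomorphism of G[X] to an automorphism φ of G.  If its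
-- domain is non-empty, φ maps some vertex of the block X into X, so φ fixes
-- the block X setwise and restricts to an automorphism of G[X].  The empty
-- partial isomorphism is extended by the identity.

module _ {VC EC : Set} (G : CCD VC EC) where

  id-isAutOn : ∀ X → IsAutOn G X id
  id-isAutOn X =
      (λ _ u∈X → u∈X)
    , (λ _ _ _ _ eq → eq)
    , (λ w w∈X → w , w∈X , refl)
    , (λ _ _ → refl)
    , (λ _ _ _ _ _ → refl)

  isIsoBetween⇒isPartialIsoOn-⊤ : ∀ {A B f} → IsIsoBetween G A B f →
                                   IsPartialIsoOn G ⊤ A B f
  isIsoBetween⇒isPartialIsoOn-⊤ iso = (λ _ _ → ∈⊤) , (λ _ _ → ∈⊤) , iso

  isAut⇒isAutOn : ∀ {φ X} → IsAut G φ → ImageIs G φ X X → IsAutOn G X φ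
  isAut⇒isAutOn (_ , inj , _ , vcol-pres , ecol-pres) φX≡X =
      (λ u u∈X → proj₂ (φX≡X _) u u∈X refl)
    , (λ u v _ _ → inj u v ∈⊤ ∈⊤)
    , (λ w → proj₁ (φX≡X w))
    , (λ u _ → vcol-pres u ∈⊤)
    , (λ u v _ _ → ecol-pres u v ∈⊤ ∈⊤)

  partition-blocks-equal : ∀ {𝓑 X Y φ x} → IsPartition G 𝓑 → X ∈ 𝓑 → Y ∈ 𝓑 →
                           ImageIs G φ X Y → x ∈ₛ X → φ x ∈ₛ X → X ≡ Y
  partition-blocks-equal (_ , _ , disjoint) X∈𝓑 Y∈𝓑 φX≡Y x∈X φx∈X =
    disjoint _ _ _ X∈𝓑 Y∈𝓑 φx∈X (proj₂ (φX≡Y _) _ x∈X refl)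

  block-stable : ∀ {𝓑 X φ x} → IsBlockSystem G 𝓑 → X ∈ 𝓑 → IsAut G φ →
                 x ∈ₛ X → φ x ∈ₛ X → ImageIs G φ X X
  block-stable {X = X} {φ} (partition , blocks) X∈𝓑 φ-aut x∈X φx∈X
    with blocks φ φ-aut X X∈𝓑
  ... | Y , Y∈𝓑 , φX≡Y =
    subst (ImageIs G φ X)
      (sym (partition-blocks-equal partition X∈𝓑 Y∈𝓑 φX≡Y x∈X φx∈X)) φX≡Y

mainTheorem7 : {VC EC : Set} (G : CCD VC EC) → Ultrahomogeneous G →
    (𝓑 : List (Subset (suc (m G)))) → IsBlockSystem G 𝓑 →
    ∀ X → X ∈ 𝓑 → UltrahomogeneousOn G X
mainTheorem7 G uh 𝓑 𝓑-blocks X X∈𝓑 A B f (A⊆X , B⊆X , f-iso) with nonempty? A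
... | no A-empty = id , id-isAutOn G X , λ u u∈A → ⊥-elim (A-empty (u , u∈A))
... | yes (a , a∈A) with uh A B f (isIsoBetween⇒isPartialIsoOn-⊤ G f-iso)
... | φ , φ-aut , φ-extends-f = φ , isAut⇒isAutOn G φ-aut φX≡X , φ-extends-f
  where
    φa∈X : φ a ∈ₛ X
    φa∈X = subst (_∈ₛ X) (sym (φ-extends-f a a∈A)) (B⊆X _ (proj₁ f-iso a a∈A))

    φX≡X : ImageIs G φ X X
    φX≡X = block-stable G 𝓑-blocks X∈𝓑 φ-aut (A⊆X a a∈A) φa∈X
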